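{- Let $H$ be a Heyting algebra and let $f$ and $g$ be monotone polynomials on $H$. For every pair of natural numbers $n,m$ such that $n+m \geq 1$, we have $f^{n}(\bot) \land g^{m}(\bot) \leq (f\land g)^{n+m-1}(\bot)$, where $(f\land g)(x)=f(x)\land g(x)$.
   Context: A function $f : H \to H$ on a Heyting algebra $H$ is a polynomial if there exist an IPC formula $\phi$, a variable $x$, and a valuation $v$ in $H$ of the variables of $\phi$ other than $x$ such that $f(h) = [\![\phi]\!]_{(v,h/x)}$ for all $h\in H$. -}

module Defs where

open import Level using (Level; _⊔_)
open import Data.Nat using (ℕ; zero; suc; _≟_)
open import Data.Product using (Σ; _×_)
open import Relation.Nullary using (yes; no)
open import Relation.Binary.Lattice.Bundles using (HeytingAlgebra)

data Formula : Set where
  var   : ℕ → Formula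
  ⊥f    : Formula
  ⊤f    : Formula
  _∧f_  : Formula → Formula → Formula
  _∨f_  : Formula → Formula → Formula
  _⇒f_  : Formula → Formula → Formula

module _ {c ℓ₁ ℓ₂ : Level} (H : HeytingAlgebra c ℓ₁ ℓ₂) where
  open HeytingAlgebra H

  Valuation : Set c
  Valuation = ℕ → Carrier

  ⟦_⟧ : Formula → Valuation → Carrier
  ⟦ var i ⟧ v = v i
  ⟦ ⊥f ⟧ v = ⊥
  ⟦ ⊤f ⟧ v = ⊤
  ⟦ φ ∧f ψ ⟧ v = ⟦ φ ⟧ v ∧ ⟦ ψ ⟧ v
  ⟦ φ ∨f ψ ⟧ v = ⟦ φ ⟧ v ∨ ⟦ ψ ⟧ v
  ⟦ φ ⇒f ψ ⟧ v = ⟦ φ ⟧ v ⇨ ⟦ ψ ⟧ v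

  _[_↦_] : Valuation → ℕ → Carrier → Valuation
  (v [ x ↦ h ]) i with i ≟ x
  ... | yes _ = h
  ... | no  _ = v i

  IsPolynomial : (Carrier → Carrier) → Set (c ⊔ ℓ₁)
  IsPolynomial f =
    Σ Formula λ φ → Σ ℕ λ x → Σ Valuation λ v →
      ∀ h → f h ≈ ⟦ φ ⟧ (v [ x ↦ h ])

  Monotone : (Carrier → Carrier) → Set (c ⊔ ℓ₂)
  Monotone f = ∀ {a b} → a ≤ b → f a ≤ f b

  iter : ℕ → (Carrier → Carrier) → Carrier → Carrier
  iter zero    f a = a
  iter (suc n) f a = f (iter n f a)

  _∧ₚ_ : (Carrier → Carrier) → (Carrier → Carrier) → Carrier → Carrier
  (f ∧ₚ g) a = f a ∧ g a

module Submission where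

open import Defs
open import Level using (Level)
open import Data.Nat using (ℕ; _+_; _∸_; _≥_; zero; suc; _≟_)
open import Data.Nat.Properties using (+-suc)
open import Data.Product using (_,_)
open import Relation.Nullary using (yes; no)
open import Relation.Binary.PropositionalEquality using (subst; sym)
open import Relation.Binary.Lattice.Bundles using (HeytingAlgebra)

-- A polynomial p satisfies (a ⇔ b) ∧ p a ≤ p b, by induction on its formula.
-- Since a ≤ b ⇔ (a ∧ b), this gives a ∧ p b ≤ p (a ∧ b).  Writing Fₖ, Gₖ and Kₖ
-- for the iterates of f, g and f ∧ g on ⊥, the inequality Fₙ₊₁ ∧ Gₘ₊₁ ≤ f (Fₙ ∧ Gₘ₊₁)
-- and its mirror image let monotonicity push the induction hypotheses for
-- (n, m + 1) and (n + 1, m) under f and g, so Fₙ₊₁ ∧ Gₘ₊₁ ≤ f Kₙ₊ₘ ∧ g Kₙ₊ₘ.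

module _ {c ℓ₁ ℓ₂ : Level} (H : HeytingAlgebra c ℓ₁ ℓ₂) where
  open HeytingAlgebra H
  open import Relation.Binary.Lattice.Properties.HeytingAlgebra H
    using (⇨-eval; ⇨-applyˡ; ∧-distribˡ-∨-≤)
  open import Relation.Binary.Lattice.Properties.MeetSemilattice meetSemilattice
    using (∧-monotonic; ∧-comm)
  open import Relation.Binary.Lattice.Properties.JoinSemilattice joinSemilattice
    using (∨-monotonic)
  open import Relation.Binary.Reasoning.PartialOrder poset

  _⇔_ : Carrier → Carrier → Carrier
  a ⇔ b = (a ⇨ b) ∧ (b ⇨ a)

  ⇔-sym : ∀ {a b} → a ⇔ b ≤ b ⇔ a
  ⇔-sym = ∧-greatest (x∧y≤y _ _) (x∧y≤x _ _)

  ⇔-∧ : ∀ {a b} → a ≤ b ⇔ (a ∧ b)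
  ⇔-∧ = ∧-greatest (transpose-⇨ refl) (transpose-⇨ (trans (x∧y≤y _ _) (x∧y≤y _ _)))

  ∧-monotonic-under : ∀ {e a a′ b b′} → e ∧ a ≤ a′ → e ∧ b ≤ b′ →
                      e ∧ (a ∧ b) ≤ a′ ∧ b′
  ∧-monotonic-under ea≤a′ eb≤b′ =
    ∧-greatest (trans (∧-monotonic refl (x∧y≤x _ _)) ea≤a′)
               (trans (∧-monotonic refl (x∧y≤y _ _)) eb≤b′)

  ∨-monotonic-under : ∀ {e a a′ b b′} → e ∧ a ≤ a′ → e ∧ b ≤ b′ →
                      e ∧ (a ∨ b) ≤ a′ ∨ b′
  ∨-monotonic-under ea≤a′ eb≤b′ =
    trans (∧-distribˡ-∨-≤ _ _ _) (∨-monotonic ea≤a′ eb≤b′)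

  ⇨-relax-under : ∀ {e a a′ b b′} → e ∧ a′ ≤ a → e ∧ b ≤ b′ →
                  e ∧ (a ⇨ b) ≤ a′ ⇨ b′
  ⇨-relax-under {e} {a} {a′} {b} {b′} ea′≤a eb≤b′ = transpose-⇨ (begin
    (e ∧ (a ⇨ b)) ∧ a′  ≤⟨ ∧-greatest (trans (x∧y≤x _ _) (x∧y≤x _ _)) apply ⟩
    e ∧ b               ≤⟨ eb≤b′ ⟩
    b′                  ∎)
    where
    apply : (e ∧ (a ⇨ b)) ∧ a′ ≤ b
    apply = trans (∧-greatest (trans (x∧y≤x _ _) (x∧y≤y _ _))
                              (∧-monotonic (x∧y≤x _ _) refl))
                  (⇨-applyˡ ea′≤a)

  poly : Formula → ℕ → Valuation H → Carrier → Carrier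
  poly φ x v a = ⟦_⟧ H φ (_[_↦_] H v x a)

  poly-transport : ∀ φ x v {a b} → (a ⇔ b) ∧ poly φ x v a ≤ poly φ x v b
  poly-transport (var i) x v with i ≟ x
  ... | yes _ = trans (∧-monotonic (x∧y≤x _ _) refl) ⇨-eval
  ... | no  _ = x∧y≤y _ _
  poly-transport ⊥f x v = x∧y≤y _ _
  poly-transport ⊤f x v = maximum _
  poly-transport (φ ∧f ψ) x v =
    ∧-monotonic-under (poly-transport φ x v) (poly-transport ψ x v)
  poly-transport (φ ∨f ψ) x v =
    ∨-monotonic-under (poly-transport φ x v) (poly-transport ψ x v)
  poly-transport (φ ⇒f ψ) x v =
    ⇨-relax-under (trans (∧-monotonic ⇔-sym refl) (poly-transport φ x v))
                  (poly-transport ψ x v)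

  polynomial-∧-≤ : ∀ {f} → IsPolynomial H f → ∀ a b → a ∧ f b ≤ f (a ∧ b)
  polynomial-∧-≤ {f} (φ , x , v , f≈poly) a b = begin
    a ∧ f b                        ≤⟨ ∧-monotonic ⇔-∧ (reflexive (f≈poly b)) ⟩
    (b ⇔ (a ∧ b)) ∧ poly φ x v b   ≤⟨ poly-transport φ x v ⟩
    poly φ x v (a ∧ b)             ≈⟨ f≈poly (a ∧ b) ⟨
    f (a ∧ b)                      ∎

  module _ {f g : Carrier → Carrier}
           (f-poly : IsPolynomial H f) (f-mono : Monotone H f)
           (g-poly : IsPolynomial H g) (g-mono : Monotone H g) where

    private
      F G K : ℕ → Carrier
      F k = iter H k f ⊥
      G k = iter H k g ⊥
      K k = iter H k (_∧ₚ_ H f g) ⊥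

    iter-∧-iter-≤ : ∀ n m → F n ∧ G m ≤ K (n + m ∸ 1)
    iter-∧-iter-≤ zero    m       = trans (x∧y≤x _ _) (minimum _)
    iter-∧-iter-≤ (suc n) zero    = trans (x∧y≤y _ _) (minimum _)
    iter-∧-iter-≤ (suc n) (suc m) =
      subst (λ k → F (suc n) ∧ G (suc m) ≤ K (k ∸ 1)) (sym (+-suc (suc n) m))
        (∧-greatest f-side g-side)
      where
      ih-f : F n ∧ G (suc m) ≤ K (n + m)
      ih-f = subst (λ k → F n ∧ G (suc m) ≤ K (k ∸ 1)) (+-suc n m) (iter-∧-iter-≤ n (suc m))

      f-side : F (suc n) ∧ G (suc m) ≤ f (K (n + m))
      f-side = begin
        f (F n) ∧ G (suc m)  ≈⟨ ∧-comm _ _ ⟩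
        G (suc m) ∧ f (F n)  ≤⟨ polynomial-∧-≤ f-poly _ _ ⟩
        f (G (suc m) ∧ F n)  ≤⟨ f-mono (trans (reflexive (∧-comm _ _)) ih-f) ⟩
        f (K (n + m))        ∎

      g-side : F (suc n) ∧ G (suc m) ≤ g (K (n + m))
      g-side = begin
        F (suc n) ∧ g (G m)  ≤⟨ polynomial-∧-≤ g-poly _ _ ⟩
        g (F (suc n) ∧ G m)  ≤⟨ g-mono (iter-∧-iter-≤ (suc n) m) ⟩
        g (K (n + m))        ∎

lemma6p9 : {c ℓ₁ ℓ₂ : Level} (H : HeytingAlgebra c ℓ₁ ℓ₂)
    (f g : HeytingAlgebra.Carrier H → HeytingAlgebra.Carrier H) →
    IsPolynomial H f → Monotone H f →
    IsPolynomial H g → Monotone H g →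
    (n m : ℕ) → n + m ≥ 1 →
    HeytingAlgebra._≤_ H
      (HeytingAlgebra._∧_ H (iter H n f (HeytingAlgebra.⊥ H)) (iter H m g (HeytingAlgebra.⊥ H)))
      (iter H (n + m ∸ 1) (_∧ₚ_ H f g) (HeytingAlgebra.⊥ H))
lemma6p9 H f g f-poly f-mono g-poly g-mono n m _ =
  iter-∧-iter-≤ H f-poly f-mono g-poly g-mono n m
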